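{- Let $q$ be a prime power, $n$ a positive integer coprime to $q$, and $\gamma\in\mathbb{Z}/n\mathbb{Z}$. Then the polynomial $M_{c_{n/q}(\gamma)}(X)$ is a binomial (i.e. of the form $X^{\tau}+a$, where $\tau=|c_{n/q}(\gamma)|$) if and only if $c_{n/q}(\gamma)$ is of equal difference.
   Context: $c_{n/q}(\gamma)=\{\gamma,\gamma q,\dots,\gamma q^{\tau-1}\}\subseteq\mathbb{Z}/n\mathbb{Z}$ with $\tau$ least positive such that $\gamma q^\tau\equiv\gamma\pmod n$. The coset is of equal difference if $\tau\mid n$ and $c_{n/q}(\gamma)=\{\gamma,\gamma+\frac n\tau,\dots,\gamma+(\tau-1)\frac n\tau\}$ in $\mathbb{Z}/n\mathbb{Z}$ (one-element cosets included). Fix in an algebraic closure of $\mathbb{F}_q$ a compatible family $\{\zeta_m:\gcd(m,q)=1\}$ of primitive $m$-th roots of unity, i.e. $\zeta_n^{n/m}=\zeta_m$ whenever $m\mid n$. Then $M_{c_{n/q}(\gamma)}(X)=\prod_{j=0}^{\tau-1}(X-\zeta_n^{\gamma q^j})$, an irreducible factor of $X^n-1$ over $\mathbb{F}_q$. -}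

module Defs where

open import Level using (Level; _⊔_)
open import Algebra.Bundles using (CommutativeRing)
open import Data.Nat as ℕ using (ℕ; zero; suc; _<_; _≤_; NonZero; _%_)
open import Data.Nat.Primality using (Prime)
open import Data.Nat.Coprimality using (Coprime)
open import Data.List using (List; []; _∷_; map; upTo; replicate; _++_; foldr)
open import Data.List.Membership.Propositional using (_∈_)
open import Data.Product using (Σ; ∃; _×_; _,_)
open import Relation.Nullary using (¬_)
open import Relation.Binary.PropositionalEquality using (_≡_)
open import Function.Bundles using (_⇔_)

-- Arithmetic in ℤ/nℤ, represented by ℕ with reduction mod n

coset : (n q γ τ : ℕ) → .{{NonZero n}} → List ℕ
coset n q γ τ = map (λ j → (γ ℕ.* q ℕ.^ j) % n) (upTo τ)

IsCosetSize : (n q γ τ : ℕ) → .{{NonZero n}} → Set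
IsCosetSize n q γ τ =
  (0 < τ) × ((γ ℕ.* q ℕ.^ τ) % n ≡ γ % n)
  × (∀ t → 0 < t → t < τ → ¬ ((γ ℕ.* q ℕ.^ t) % n ≡ γ % n))

EqualDifference : (n q γ τ : ℕ) → .{{NonZero n}} → Set
EqualDifference n q γ τ =
  Σ ℕ λ d → (n ≡ τ ℕ.* d)
    × (∀ x → (x ∈ coset n q γ τ) ⇔ (x ∈ map (λ i → (γ ℕ.+ i ℕ.* d) % n) (upTo τ)))

-- Fields, polynomials (coefficient lists, lowest degree first)

module _ {c ℓ : Level} (K : CommutativeRing c ℓ) where
  open CommutativeRing K

  Poly : Set c
  Poly = List Carrier

  ι : ℕ → Carrier
  ι zero = 0#
  ι (suc n) = 1# + ι n

  pow : Carrier → ℕ → Carrier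
  pow x zero = 1#
  pow x (suc n) = x * pow x n

  coeff : Poly → ℕ → Carrier
  coeff [] i = 0#
  coeff (a ∷ f) zero = a
  coeff (a ∷ f) (suc i) = coeff f i

  addP : Poly → Poly → Poly
  addP [] g = g
  addP (a ∷ f) [] = a ∷ f
  addP (a ∷ f) (b ∷ g) = (a + b) ∷ addP f g

  scaleP : Carrier → Poly → Poly
  scaleP a = map (a *_)

  mulP : Poly → Poly → Poly
  mulP [] g = []
  mulP (a ∷ f) g = addP (scaleP a g) (0# ∷ mulP f g)

  prodP : List Poly → Poly
  prodP = foldr mulP (1# ∷ [])

  eval : Poly → Carrier → Carrier
  eval [] x = 0#
  eval (a ∷ f) x = a + x * eval f x

  linear : Carrier → Poly
  linear r = (- r) ∷ 1# ∷ []

  binomialPoly : ℕ → Carrier → Poly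
  binomialPoly τ a = addP (a ∷ []) (replicate τ 0# ++ (1# ∷ []))

  -- f is a binomial X^τ + a (equality of polynomials = equality of all coefficients)
  IsBinomial : Poly → ℕ → Set (c ⊔ ℓ)
  IsBinomial f τ = ∃ λ a → ∀ i → coeff f i ≈ coeff (binomialPoly τ a) i

  record IsField : Set (c ⊔ ℓ) where
    field
      1≉0     : ¬ (1# ≈ 0#)
      inverse : ∀ x → ¬ (x ≈ 0#) → ∃ λ y → x * y ≈ 1#

  -- K is an algebraic closure of 𝔽_p (hence of 𝔽_q for q a power of p):
  -- a field of characteristic p, algebraic over the prime field, algebraically closed
  record IsAlgClosureOfFp (p : ℕ) : Set (c ⊔ ℓ) where
    field
      isField      : IsField
      char-p       : ι p ≈ 0#
      algebraic    : ∀ x → ∃ λ (cs : List ℕ) → eval (map ι cs ++ (1# ∷ [])) x ≈ 0#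
      algClosed    : ∀ (a : Carrier) (cs : Poly) → ∃ λ x → eval (a ∷ cs ++ (1# ∷ [])) x ≈ 0#

  IsPrimitiveRoot : ℕ → Carrier → Set ℓ
  IsPrimitiveRoot m z = (pow z m ≈ 1#) × (∀ k → 0 < k → k < m → ¬ (pow z k ≈ 1#))

  record CompatibleRoots (q : ℕ) (ζ : ℕ → Carrier) : Set (c ⊔ ℓ) where
    field
      isPrimitive : ∀ m → 0 < m → Coprime m q → IsPrimitiveRoot m (ζ m)
      compatible : ∀ m d → 0 < m ℕ.* d → Coprime (m ℕ.* d) q → pow (ζ (m ℕ.* d)) d ≈ ζ m

  minPolyCoset : (ζ : ℕ → Carrier) (n q γ τ : ℕ) → Poly
  minPolyCoset ζ n q γ τ = prodP (map (λ j → linear (pow (ζ n) (γ ℕ.* q ℕ.^ j))) (upTo τ))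

-- Write ρⱼ = ζₙ^(γqʲ), j < τ, for the roots of M = ∏ⱼ (X − ρⱼ). They are pairwise distinct, because q is
-- invertible modulo n and τ is the least period of γ. Over a field a monic polynomial of degree τ with τ
-- distinct roots is the product of the corresponding linear factors, so M = X^τ + a exactly when all ρⱼ^τ
-- coincide, i.e. when γqʲτ ≡ γτ (mod n) for every j. Cancelling τ, this says that every coset element is
-- congruent to γ modulo n′ = n / gcd(n, τ). That class contains only gcd(n, τ) residues modulo n, namely
-- γ + i·n′ for i < gcd(n, τ), and gcd(n, τ) divides τ; so the τ distinct coset elements exhaust it, whence
-- gcd(n, τ) = τ and the coset is {γ + i·n/τ}. Conversely, multiplying γ + i·n/τ by τ gives γτ modulo n.

module Submission where

open import Defs
open import Level using (Level)
open import Algebra.Bundles using (CommutativeRing)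
open import Data.Nat using (ℕ; _<_; _^_; NonZero)
open import Data.Nat.Primality using (Prime)
open import Data.Nat.Coprimality using (Coprime)
open import Data.Fin using (Fin; toℕ)
open import Function.Bundles using (_⇔_)

open import Data.Nat.Base using (>-nonZero⁻¹)
open import Data.List.Base using (map; upTo)
open import Data.List.Properties using (map-∘)
open import Data.Product.Base using (_,_)
open import Function.Properties.Equivalence using () renaming (trans to ⇔-trans)
import Relation.Binary.PropositionalEquality as ≡

module ModularArithmetic where

  open import Data.Nat.Base
  open import Data.Nat.Properties
  open import Data.Nat.DivMod
  open import Data.Nat.Divisibility
  open import Data.Nat.GCD using (gcd; gcd[m,n]∣m; gcd[m,n]∣n; gcd[m,n]≢0; gcd[m,n]≤n; m/gcd[m,n]≢0)
  open import Data.Nat.Coprimality using (Coprime; coprime-divisor; coprime-/gcd)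
  open import Data.Fin.Base using (Fin; toℕ; fromℕ<; punchOut)
  open import Data.Fin.Properties
    using (toℕ<n; toℕ-fromℕ<; toℕ-injective; any?; injective⇒≤; punchOut-injective) renaming (_≟_ to _≟ᶠ_)
  open import Data.List.Base using (map; upTo)
  open import Data.List.Membership.Propositional using (_∈_)
  open import Data.List.Membership.Propositional.Properties using (∈-map⁺; ∈-map⁻; ∈-upTo⁺; ∈-upTo⁻)
  open import Data.Product.Base using (∃; _×_; _,_)
  open import Data.Sum.Base using ([_,_]′; inj₁)
  open import Function.Base using (_∘_)
  open import Function.Bundles using (_⇔_; mk⇔; Equivalence)
  open import Function.Definitions using (Injective)
  open import Relation.Nullary using (yes; no; contradiction)
  open import Relation.Binary.Definitions using (tri<; tri≈; tri>)
  open import Relation.Binary.PropositionalEquality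
  open import Algebra.Properties.CommutativeSemigroup *-commutativeSemigroup using (x∙yz≈y∙xz)

  %≡%⇒∣∣-∣ : ∀ a b n .{{_ : NonZero n}} → a % n ≡ b % n → n ∣ ∣ a - b ∣
  %≡%⇒∣∣-∣ a b n eq = divides ∣ a / n - b / n ∣ (begin
    ∣ a - b ∣                                  ≡⟨ cong₂ ∣_-_∣ (m≡m%n+[m/n]*n a n) (m≡m%n+[m/n]*n b n) ⟩
    ∣ a % n + a / n * n - b % n + b / n * n ∣  ≡⟨ cong (λ r → ∣ a % n + a / n * n - r + b / n * n ∣) eq ⟨
    ∣ a % n + a / n * n - a % n + b / n * n ∣  ≡⟨ ∣m+n-m+o∣≡∣n-o∣ (a % n) _ _ ⟩
    ∣ a / n * n - b / n * n ∣                  ≡⟨ *-distribʳ-∣-∣ n (a / n) (b / n) ⟨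
    ∣ a / n - b / n ∣ * n                      ∎)
    where open ≡-Reasoning

  ∣∣-∣⇒%≡% : ∀ a b n .{{_ : NonZero n}} → n ∣ ∣ a - b ∣ → a % n ≡ b % n
  ∣∣-∣⇒%≡% a b n n∣∣a-b∣ =
    [ (λ a≤b → sym (upper≡lower a≤b n∣∣a-b∣))
    , (λ b≤a → upper≡lower b≤a (subst (n ∣_) (∣-∣-comm a b) n∣∣a-b∣))
    ]′ (≤-total a b)
    where
    upper≡lower : ∀ {x y} → x ≤ y → n ∣ ∣ x - y ∣ → y % n ≡ x % n
    upper≡lower {x} {y} x≤y n∣∣x-y∣ = begin
      y % n             ≡⟨ cong (_% n) (m+[n∸m]≡n x≤y) ⟨
      (x + (y ∸ x)) % n ≡⟨ %-remove-+ʳ x (subst (n ∣_) (m≤n⇒∣m-n∣≡n∸m x≤y) n∣∣x-y∣) ⟩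
      x % n             ∎
      where open ≡-Reasoning

  %≡%⇒*%≡*% : ∀ {a b} c n .{{_ : NonZero n}} → a % n ≡ b % n → (a * c) % n ≡ (b * c) % n
  %≡%⇒*%≡*% {a} {b} c n eq = begin
    (a * c) % n             ≡⟨ %-distribˡ-* a c n ⟩
    (a % n * (c % n)) % n   ≡⟨ cong (λ r → (r * (c % n)) % n) eq ⟩
    (b % n * (c % n)) % n   ≡⟨ %-distribˡ-* b c n ⟨
    (b * c) % n             ∎
    where open ≡-Reasoning

  *%≡*%⇒%≡% : ∀ {a b c} n .{{_ : NonZero n}} → Coprime n c → (c * a) % n ≡ (c * b) % n → a % n ≡ b % n
  *%≡*%⇒%≡% {a} {b} {c} n n⊥c eq = ∣∣-∣⇒%≡% a b n (coprime-divisor n⊥c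
    (subst (n ∣_) (sym (*-distribˡ-∣-∣ c a b)) (%≡%⇒∣∣-∣ (c * a) (c * b) n eq)))

  *%≡*%⇒%/gcd≡% : ∀ {a b} c n .{{_ : NonZero n}} .{{_ : NonZero (gcd n c)}} .{{_ : NonZero (n / gcd n c)}} →
                  (a * c) % n ≡ (b * c) % n → a % (n / gcd n c) ≡ b % (n / gcd n c)
  *%≡*%⇒%/gcd≡% {a} {b} c n eq = ∣∣-∣⇒%≡% a b n′ (coprime-divisor (coprime-/gcd n c)
    (subst (n′ ∣_) (*-comm ∣ a - b ∣ c′) (*-cancelʳ-∣ g n′g∣∣a-b∣c′g)))
    where
    g n′ c′ : ℕ
    g  = gcd n c
    n′ = n / g
    c′ = c / g
    n′g∣∣a-b∣c′g : n′ * g ∣ ∣ a - b ∣ * c′ * g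
    n′g∣∣a-b∣c′g = subst₂ _∣_ (sym (m/n*n≡m (gcd[m,n]∣m n c)))
      (trans (cong (∣ a - b ∣ *_) (sym (m/n*n≡m (gcd[m,n]∣n n c)))) (sym (*-assoc ∣ a - b ∣ c′ g)))
      (subst (n ∣_) (sym (*-distribʳ-∣-∣ c a b)) (%≡%⇒∣∣-∣ (a * c) (b * c) n eq))

  coprime-* : ∀ {n a b} → Coprime n a → Coprime n b → Coprime n (a * b)
  coprime-* {n} {a} {b} n⊥a n⊥b (d∣n , d∣ab) = n⊥b (d∣n , coprime-divisor d⊥a d∣ab)
    where
    d⊥a : Coprime _ a
    d⊥a (e∣d , e∣a) = n⊥a (∣-trans e∣d d∣n , e∣a)

  coprime-^ : ∀ {n a} → Coprime n a → ∀ i → Coprime n (a ^ i)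
  coprime-^ n⊥a zero    (_ , d∣1) = ∣1⇒≡1 d∣1
  coprime-^ n⊥a (suc i) = coprime-* n⊥a (coprime-^ n⊥a i)

  ∈-map-upTo⁺ : ∀ {k} (f : ℕ → ℕ) (i : Fin k) → f (toℕ i) ∈ map f (upTo k)
  ∈-map-upTo⁺ f i = ∈-map⁺ f (∈-upTo⁺ (toℕ<n i))

  ∈-map-upTo⁻ : ∀ {k x} (f : ℕ → ℕ) → x ∈ map f (upTo k) → ∃ λ (i : Fin k) → f (toℕ i) ≡ x
  ∈-map-upTo⁻ f x∈ with i , i∈ , refl ← ∈-map⁻ f x∈ = fromℕ< (∈-upTo⁻ i∈) , cong f (toℕ-fromℕ< _)

  m<n⇒n∣m⇒m≡0 : ∀ {m n} → m < n → n ∣ m → m ≡ 0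
  m<n⇒n∣m⇒m≡0 {zero}  _   _   = refl
  m<n⇒n∣m⇒m≡0 {suc m} m<n n∣m = contradiction n∣m (>⇒∤ m<n)

  injective⇒surjective : ∀ {k} {f : Fin k → Fin k} → Injective _≡_ _≡_ f → ∀ y → ∃ λ x → f x ≡ y
  injective⇒surjective {suc k} {f} f-inj y with any? (λ x → f x ≟ᶠ y)
  ... | yes found = found
  ... | no  ¬found = contradiction (injective⇒≤ punchOut-f-injective) (n≮n k)
    where
    f≢y : ∀ x → y ≢ f x
    f≢y x y≡fx = ¬found (x , sym y≡fx)
    punchOut-f-injective : Injective _≡_ _≡_ (λ x → punchOut (f≢y x))
    punchOut-f-injective eq = f-inj (punchOut-injective (f≢y _) (f≢y _) eq)

  -- The residues x < n = k·m with x ≡ r (mod m); x ↦ x / m embeds them into Fin k.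
  module ResidueClass (n m k r : ℕ) .{{_ : NonZero n}} .{{_ : NonZero m}} (n≡k*m : n ≡ k * m) where

    InClass : ℕ → Set
    InClass x = x < n × x % m ≡ r

    %-InClass : ∀ x → x % m ≡ r → InClass (x % n)
    %-InClass x x%m≡r = m%n<n x n , trans (m∣n⇒o%n%m≡o%m m n x (divides k n≡k*m)) x%m≡r

    index : ∀ {x} → InClass x → Fin k
    index {x} (x<n , _) = fromℕ< (m<n*o⇒m/o<n (subst (x <_) n≡k*m x<n))

    toℕ-index : ∀ {x} (x∈ : InClass x) → toℕ (index x∈) ≡ x / m
    toℕ-index (x<n , _) = toℕ-fromℕ< _

    index-injective : ∀ {x y} (x∈ : InClass x) (y∈ : InClass y) → index x∈ ≡ index y∈ → x ≡ y
    index-injective {x} {y} x∈@(_ , x%m≡r) y∈@(_ , y%m≡r) eq = begin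
      x                 ≡⟨ m≡m%n+[m/n]*n x m ⟩
      x % m + x / m * m ≡⟨ cong₂ (λ a b → a + b * m) (trans x%m≡r (sym y%m≡r)) x/m≡y/m ⟩
      y % m + y / m * m ≡⟨ m≡m%n+[m/n]*n y m ⟨
      y                 ∎
      where
      open ≡-Reasoning
      x/m≡y/m : x / m ≡ y / m
      x/m≡y/m = trans (sym (toℕ-index x∈)) (trans (cong toℕ eq) (toℕ-index y∈))

    module _ {l} (f : Fin l → ℕ) (f-injective : Injective _≡_ _≡_ f) (f∈ : ∀ i → InClass (f i)) where

      index∘f-injective : Injective _≡_ _≡_ (λ i → index (f∈ i))
      index∘f-injective eq = f-injective (index-injective (f∈ _) (f∈ _) eq)

      enumeration-length≤ : l ≤ k
      enumeration-length≤ = injective⇒≤ index∘f-injective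

    enumeration-complete : (f : Fin k → ℕ) → Injective _≡_ _≡_ f → (∀ i → InClass (f i)) →
                           ∀ {x} → InClass x → ∃ λ i → f i ≡ x
    enumeration-complete f f-injective f∈ x∈ =
      let i , eq = injective⇒surjective (index∘f-injective f f-injective f∈) (index x∈)
      in  i , index-injective (f∈ i) x∈ eq

    enumeration-⊆ : (f g : ℕ → ℕ) → (∀ (i : Fin k) → InClass (f (toℕ i))) →
                    Injective _≡_ _≡_ (g ∘ toℕ {k}) → (∀ (i : Fin k) → InClass (g (toℕ i))) →
                    ∀ {x} → x ∈ map f (upTo k) → x ∈ map g (upTo k)
    enumeration-⊆ f g f∈ g-injective g∈ x∈f with i , refl ← ∈-map-upTo⁻ f x∈f
      with j , gj≡fi ← enumeration-complete (g ∘ toℕ) g-injective g∈ (f∈ i)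
      = subst (_∈ map g (upTo k)) gj≡fi (∈-map-upTo⁺ g j)

    progression : ℕ → ℕ → ℕ
    progression a i = (a + i * m) % n

    progression-injective : ∀ a → Injective _≡_ _≡_ (progression a ∘ toℕ {k})
    progression-injective a {i} {j} eq = toℕ-injective (∣m-n∣≡0⇒m≡n (m<n⇒n∣m⇒m≡0 ∣i-j∣<k k∣∣i-j∣))
      where
      ∣i-j∣<k : ∣ toℕ i - toℕ j ∣ < k
      ∣i-j∣<k = ≤-<-trans (∣m-n∣≤m⊔n (toℕ i) (toℕ j)) (⊔-lub (toℕ<n i) (toℕ<n j))
      k∣∣i-j∣ : k ∣ ∣ toℕ i - toℕ j ∣
      k∣∣i-j∣ = *-cancelʳ-∣ m (subst₂ _∣_ n≡k*m
        (trans (∣m+n-m+o∣≡∣n-o∣ a _ _) (sym (*-distribʳ-∣-∣ m (toℕ i) (toℕ j))))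
        (%≡%⇒∣∣-∣ _ _ n eq))

    progression-InClass : ∀ {a} → a % m ≡ r → ∀ i → InClass (progression a i)
    progression-InClass {a} a%m≡r i = %-InClass (a + i * m) (trans ([m+kn]%n≡m%n a i m) a%m≡r)

  module CyclotomicCoset (n q γ τ : ℕ) .{{_ : NonZero n}} where

    cosetElem : ℕ → ℕ
    cosetElem j = (γ * q ^ j) % n

    cosetElem-distinct : IsCosetSize n q γ τ → Coprime n q →
                         ∀ {i j} → i < j → j < τ → cosetElem i ≢ cosetElem j
    cosetElem-distinct (_ , _ , minimal) n⊥q {i} {j} i<j j<τ eq =
      minimal (j ∸ i) (m<n⇒0<n∸m i<j) (≤-<-trans (m∸n≤m j i) j<τ) (sym γ≡γq^[j-i])
      where
      γq^j≡ : γ * q ^ j ≡ q ^ i * (γ * q ^ (j ∸ i))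
      γq^j≡ = begin
        γ * q ^ j                  ≡⟨ cong (λ e → γ * q ^ e) (m+[n∸m]≡n (<⇒≤ i<j)) ⟨
        γ * q ^ (i + (j ∸ i))      ≡⟨ cong (γ *_) (^-distribˡ-+-* q i (j ∸ i)) ⟩
        γ * (q ^ i * q ^ (j ∸ i))  ≡⟨ x∙yz≈y∙xz γ (q ^ i) (q ^ (j ∸ i)) ⟩
        q ^ i * (γ * q ^ (j ∸ i))  ∎
        where open ≡-Reasoning
      γ≡γq^[j-i] : γ % n ≡ (γ * q ^ (j ∸ i)) % n
      γ≡γq^[j-i] = *%≡*%⇒%≡% n (coprime-^ n⊥q i)
        (subst₂ (λ a b → a % n ≡ b % n) (*-comm γ (q ^ i)) γq^j≡ eq)

    cosetElem-injective : IsCosetSize n q γ τ → Coprime n q → Injective _≡_ _≡_ (cosetElem ∘ toℕ {τ})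
    cosetElem-injective size n⊥q {i} {j} eq with <-cmp (toℕ i) (toℕ j)
    ... | tri< i<j _ _ = contradiction eq (cosetElem-distinct size n⊥q i<j (toℕ<n j))
    ... | tri≈ _ i≡j _ = toℕ-injective i≡j
    ... | tri> _ _ j<i = contradiction (sym eq) (cosetElem-distinct size n⊥q j<i (toℕ<n i))

    TimesτConstant : Set
    TimesτConstant = ∀ j → j < τ → (γ * q ^ j * τ) % n ≡ (γ * τ) % n

    equalDifference⇒timesτConstant : EqualDifference n q γ τ → TimesτConstant
    equalDifference⇒timesτConstant (d , n≡τ*d , sameMembers) j j<τ
      with i , _ , γq^j≡γ+id ← ∈-map⁻ _ (Equivalence.to (sameMembers _) (∈-map⁺ cosetElem (∈-upTo⁺ j<τ)))
      = begin
        (γ * q ^ j * τ) % n    ≡⟨ %≡%⇒*%≡*% τ n γq^j≡γ+id ⟩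
        ((γ + i * d) * τ) % n  ≡⟨ cong (_% n) [γ+id]τ≡γτ+in ⟩
        (γ * τ + i * n) % n    ≡⟨ [m+kn]%n≡m%n (γ * τ) i n ⟩
        (γ * τ) % n            ∎
      where
      open ≡-Reasoning
      [γ+id]τ≡γτ+in : (γ + i * d) * τ ≡ γ * τ + i * n
      [γ+id]τ≡γτ+in = begin
        (γ + i * d) * τ        ≡⟨ *-distribʳ-+ τ γ (i * d) ⟩
        γ * τ + i * d * τ      ≡⟨ cong (γ * τ +_) (*-assoc i d τ) ⟩
        γ * τ + i * (d * τ)    ≡⟨ cong (λ e → γ * τ + i * e) (trans (*-comm d τ) (sym n≡τ*d)) ⟩
        γ * τ + i * n          ∎

    timesτConstant⇒equalDifference : IsCosetSize n q γ τ → Coprime n q →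
                                     TimesτConstant → EqualDifference n q γ τ
    timesτConstant⇒equalDifference size@(0<τ , _) n⊥q constant = m , n≡τ*m , λ _ → mk⇔
      (enumeration-⊆ cosetElem (progression γ) coset∈ (progression-injective γ) progression∈)
      (enumeration-⊆ (progression γ) cosetElem progression∈ (cosetElem-injective size n⊥q) coset∈)
      where
      G : ℕ
      G = gcd n τ
      instance
        τ≢0 : NonZero τ
        τ≢0 = >-nonZero 0<τ
        G≢0 : NonZero G
        G≢0 = ≢-nonZero (gcd[m,n]≢0 n τ (inj₁ (≢-nonZero⁻¹ n)))
      m : ℕ
      m = n / G
      instance
        m≢0 : NonZero m
        m≢0 = ≢-nonZero (m/gcd[m,n]≢0 n τ)

      n≡G*m : n ≡ G * m
      n≡G*m = sym (m*[n/m]≡n (gcd[m,n]∣m n τ))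

      module ClassOfSizeG = ResidueClass n m G (γ % m) n≡G*m

      coset∈ : ∀ (j : Fin τ) → ClassOfSizeG.InClass (cosetElem (toℕ j))
      coset∈ j = ClassOfSizeG.%-InClass (γ * q ^ toℕ j) (*%≡*%⇒%/gcd≡% τ n (constant (toℕ j) (toℕ<n j)))

      τ≡G : τ ≡ G
      τ≡G = ≤-antisym
        (ClassOfSizeG.enumeration-length≤ (cosetElem ∘ toℕ) (cosetElem-injective size n⊥q) coset∈)
        (gcd[m,n]≤n n τ)

      n≡τ*m : n ≡ τ * m
      n≡τ*m = trans n≡G*m (cong (_* m) (sym τ≡G))

      open ResidueClass n m τ (γ % m) n≡τ*m

      progression∈ : ∀ (i : Fin τ) → InClass (progression γ (toℕ i))
      progression∈ i = progression-InClass refl (toℕ i)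

    timesτConstant⇔equalDifference : IsCosetSize n q γ τ → Coprime n q →
                                     TimesτConstant ⇔ EqualDifference n q γ τ
    timesτConstant⇔equalDifference size n⊥q =
      mk⇔ (timesτConstant⇒equalDifference size n⊥q) equalDifference⇒timesτConstant

module Polynomials {c ℓ : Level} (K : CommutativeRing c ℓ) where

  open import Level using (_⊔_)
  open CommutativeRing K hiding (zero)
  open import Data.Nat.Base using (zero; suc)
  open import Data.Nat.Properties using (suc-injective)
  open import Data.List.Base using (List; []; _∷_; map; replicate; _++_; length)
  open import Data.List.Relation.Unary.All as All using (All; []; _∷_)
  open import Data.List.Relation.Unary.AllPairs using (AllPairs; []; _∷_)
  open import Data.List.Relation.Unary.Any using (here; there)
  open import Data.List.Membership.Propositional using (_∈_)
  open import Data.Product.Base using (∃; _,_)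
  open import Function.Bundles using (_⇔_; mk⇔)
  open import Relation.Nullary using (¬_)
  import Relation.Binary.PropositionalEquality as ≡
  open import Relation.Binary.Reasoning.Setoid setoid
  open import Algebra.Properties.CommutativeSemigroup +-commutativeSemigroup using (interchange; x∙yz≈y∙xz)
  open import Algebra.Properties.CommutativeSemigroup *-commutativeSemigroup as * using ()
  open import Algebra.Properties.Group +-group using (x∙y⁻¹≈ε⇒x≈y; inverseʳ-unique)

  infix 4 _≈ₚ_
  _≈ₚ_ : Poly K → Poly K → Set ℓ
  f ≈ₚ g = ∀ i → coeff K f i ≈ coeff K g i

  IsRoot : Poly K → Carrier → Set ℓ
  IsRoot f x = eval K f x ≈ 0#

  EqualPowers : ℕ → List Carrier → Set (c ⊔ ℓ)
  EqualPowers τ rs = ∃ λ b → All (λ r → pow K r τ ≈ b) rs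

  record IsMonic (m : ℕ) (f : Poly K) : Set ℓ where
    constructor monic
    field
      length≡ : length f ≡.≡ suc m
      top≈1   : coeff K f m ≈ 1#

  coeff-addP : ∀ f g i → coeff K (addP K f g) i ≈ coeff K f i + coeff K g i
  coeff-addP []      g       i       = sym (+-identityˡ _)
  coeff-addP (a ∷ f) []      i       = sym (+-identityʳ _)
  coeff-addP (a ∷ f) (b ∷ g) zero    = refl
  coeff-addP (a ∷ f) (b ∷ g) (suc i) = coeff-addP f g i

  coeff-scaleP : ∀ a f i → coeff K (scaleP K a f) i ≈ a * coeff K f i
  coeff-scaleP a []      i       = sym (zeroʳ a)
  coeff-scaleP a (b ∷ f) zero    = refl
  coeff-scaleP a (b ∷ f) (suc i) = coeff-scaleP a f i

  coeff-[0] : ∀ i → coeff K (0# ∷ []) i ≈ 0#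
  coeff-[0] zero    = refl
  coeff-[0] (suc i) = refl

  mulP-identityˡ : ∀ f → mulP K (1# ∷ []) f ≈ₚ f
  mulP-identityˡ f i = begin
    coeff K (addP K (scaleP K 1# f) (0# ∷ [])) i  ≈⟨ coeff-addP (scaleP K 1# f) (0# ∷ []) i ⟩
    coeff K (scaleP K 1# f) i + coeff K (0# ∷ []) i ≈⟨ +-cong (coeff-scaleP 1# f i) (coeff-[0] i) ⟩
    1# * coeff K f i + 0#                          ≈⟨ trans (+-identityʳ _) (*-identityˡ _) ⟩
    coeff K f i                                    ∎

  linearMulCoeff : Carrier → Poly K → ℕ → Carrier
  linearMulCoeff r g zero    = - r * coeff K g zero
  linearMulCoeff r g (suc i) = - r * coeff K g (suc i) + coeff K g i

  coeff-mulP-linear : ∀ r g i → coeff K (mulP K (linear K r) g) i ≈ linearMulCoeff r g i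
  coeff-mulP-linear r g i with coeff-addP (scaleP K (- r) g) (0# ∷ mulP K (1# ∷ []) g) i
  coeff-mulP-linear r g zero    | eq = trans eq (trans (+-identityʳ _) (coeff-scaleP (- r) g zero))
  coeff-mulP-linear r g (suc i) | eq = trans eq (+-cong (coeff-scaleP (- r) g (suc i)) (mulP-identityˡ g i))

  linearMulCoeff-cong : ∀ r {f g} → f ≈ₚ g → ∀ i → linearMulCoeff r f i ≈ linearMulCoeff r g i
  linearMulCoeff-cong r f≈g zero    = *-congˡ (f≈g zero)
  linearMulCoeff-cong r f≈g (suc i) = +-cong (*-congˡ (f≈g (suc i))) (f≈g i)

  eval-const : ∀ a x → eval K (a ∷ []) x ≈ a
  eval-const a x = trans (+-congˡ (zeroʳ x)) (+-identityʳ a)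

  eval-addP : ∀ f g x → eval K (addP K f g) x ≈ eval K f x + eval K g x
  eval-addP []      g       x = sym (+-identityˡ _)
  eval-addP (a ∷ f) []      x = sym (+-identityʳ _)
  eval-addP (a ∷ f) (b ∷ g) x = begin
    (a + b) + x * eval K (addP K f g) x          ≈⟨ +-congˡ (*-congˡ (eval-addP f g x)) ⟩
    (a + b) + x * (eval K f x + eval K g x)      ≈⟨ +-congˡ (distribˡ x _ _) ⟩
    (a + b) + (x * eval K f x + x * eval K g x)  ≈⟨ interchange a b _ _ ⟩
    (a + x * eval K f x) + (b + x * eval K g x)  ∎

  eval-scaleP : ∀ a f x → eval K (scaleP K a f) x ≈ a * eval K f x
  eval-scaleP a []      x = sym (zeroʳ a)
  eval-scaleP a (b ∷ f) x = begin
    a * b + x * eval K (scaleP K a f) x  ≈⟨ +-congˡ (*-congˡ (eval-scaleP a f x)) ⟩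
    a * b + x * (a * eval K f x)         ≈⟨ +-congˡ (*.x∙yz≈y∙xz x a _) ⟩
    a * b + a * (x * eval K f x)         ≈⟨ distribˡ a b _ ⟨
    a * (b + x * eval K f x)             ∎

  eval-mulP : ∀ f g x → eval K (mulP K f g) x ≈ eval K f x * eval K g x
  eval-mulP []      g x = sym (zeroˡ _)
  eval-mulP (a ∷ f) g x = begin
    eval K (addP K (scaleP K a g) (0# ∷ mulP K f g)) x    ≈⟨ eval-addP (scaleP K a g) _ x ⟩
    eval K (scaleP K a g) x + (0# + x * eval K (mulP K f g) x)
      ≈⟨ +-cong (eval-scaleP a g x) (trans (+-identityˡ _) (*-congˡ (eval-mulP f g x))) ⟩
    a * G + x * (eval K f x * G)                          ≈⟨ +-congˡ (*-assoc x _ G) ⟨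
    a * G + x * eval K f x * G                            ≈⟨ distribʳ G a _ ⟨
    (a + x * eval K f x) * G                              ∎
    where
    G : Carrier
    G = eval K g x

  eval-linear : ∀ r x → eval K (linear K r) x ≈ x - r
  eval-linear r x = begin
    - r + x * (1# + x * 0#)  ≈⟨ +-congˡ (*-congˡ (eval-const 1# x)) ⟩
    - r + x * 1#             ≈⟨ trans (+-congˡ (*-identityʳ x)) (+-comm (- r) x) ⟩
    x - r                    ∎

  eval-mulP-linear : ∀ r g x → eval K (mulP K (linear K r) g) x ≈ (x - r) * eval K g x
  eval-mulP-linear r g x = trans (eval-mulP (linear K r) g x) (*-congʳ (eval-linear r x))

  eval-≈ₚ[] : ∀ g → [] ≈ₚ g → ∀ x → eval K g x ≈ 0#
  eval-≈ₚ[] []      _    x = refl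
  eval-≈ₚ[] (b ∷ g) []≈g x = begin
    b + x * eval K g x  ≈⟨ +-cong (sym ([]≈g zero)) (*-congˡ (eval-≈ₚ[] g (λ i → []≈g (suc i)) x)) ⟩
    0# + x * 0#         ≈⟨ trans (+-identityˡ _) (zeroʳ x) ⟩
    0#                  ∎

  eval-cong : ∀ f g → f ≈ₚ g → ∀ x → eval K f x ≈ eval K g x
  eval-cong []      g       f≈g x = sym (eval-≈ₚ[] g f≈g x)
  eval-cong (a ∷ f) []      f≈g x = eval-≈ₚ[] (a ∷ f) (λ i → sym (f≈g i)) x
  eval-cong (a ∷ f) (b ∷ g) f≈g x = +-cong (f≈g zero) (*-congˡ (eval-cong f g (λ i → f≈g (suc i)) x))

  IsRoot-prodP-linear : ∀ {r rs} → r ∈ rs → IsRoot (prodP K (map (linear K) rs)) r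
  IsRoot-prodP-linear {r} {s ∷ rs} r∈s∷rs = begin
    eval K (mulP K (linear K s) P) r  ≈⟨ eval-mulP-linear s P r ⟩
    (r - s) * eval K P r              ≈⟨ factor≈0 r∈s∷rs ⟩
    0#                                ∎
    where
    P : Poly K
    P = prodP K (map (linear K) rs)
    factor≈0 : r ∈ s ∷ rs → (r - s) * eval K P r ≈ 0#
    factor≈0 (here ≡.refl)  = trans (*-congʳ (-‿inverseʳ r)) (zeroˡ _)
    factor≈0 (there r∈rs) = trans (*-congˡ (IsRoot-prodP-linear r∈rs)) (zeroʳ _)

  eval-monomial : ∀ t x → eval K (replicate t 0# ++ 1# ∷ []) x ≈ pow K x t
  eval-monomial zero    x = eval-const 1# x
  eval-monomial (suc t) x = trans (+-identityˡ _) (*-congˡ (eval-monomial t x))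

  eval-binomialPoly : ∀ τ a x → eval K (binomialPoly K τ a) x ≈ a + pow K x τ
  eval-binomialPoly τ a x =
    trans (eval-addP (a ∷ []) (replicate τ 0# ++ 1# ∷ []) x) (+-cong (eval-const a x) (eval-monomial τ x))

  ∷-monic : ∀ {m f} a → IsMonic m f → IsMonic (suc m) (a ∷ f)
  ∷-monic a (monic length≡ top≈1) = monic (≡.cong suc length≡) top≈1

  monomial-monic : ∀ t → IsMonic t (replicate t 0# ++ 1# ∷ [])
  monomial-monic zero    = monic ≡.refl refl
  monomial-monic (suc t) = ∷-monic 0# (monomial-monic t)

  binomialPoly-monic : ∀ t a → IsMonic (suc t) (binomialPoly K (suc t) a)
  binomialPoly-monic t a = ∷-monic (a + 0#) (monomial-monic t)

  monic-degree0 : ∀ {f} → IsMonic 0 f → f ≈ₚ 1# ∷ []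
  monic-degree0 {a ∷ []} (monic _ a≈1) zero    = a≈1
  monic-degree0 {a ∷ []} (monic _ a≈1) (suc i) = refl

  quotLinear : Carrier → Poly K → Poly K
  quotLinear r []                = []
  quotLinear r (a ∷ [])          = []
  quotLinear r (a ∷ f@(_ ∷ _))   = eval K f r ∷ quotLinear r f

  quotLinear-monic : ∀ {m} r f → IsMonic (suc m) f → IsMonic m (quotLinear r f)
  quotLinear-monic {zero}  r (a ∷ b ∷ [])     (monic _ b≈1)       = monic ≡.refl (trans (eval-const b r) b≈1)
  quotLinear-monic {suc m} r (a ∷ b ∷ c ∷ f) (monic length≡ top≈1) =
    ∷-monic _ (quotLinear-monic r (b ∷ c ∷ f) (monic (suc-injective length≡) top≈1))

  a≈-rs+[a+rs] : ∀ a r s → a ≈ - r * s + (a + r * s)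
  a≈-rs+[a+rs] a r s = sym (begin
    - r * s + (a + r * s)  ≈⟨ x∙yz≈y∙xz (- r * s) a (r * s) ⟩
    a + (- r * s + r * s)  ≈⟨ +-congˡ (distribʳ s (- r) r) ⟨
    a + (- r + r) * s      ≈⟨ +-congˡ (trans (*-congʳ (-‿inverseˡ r)) (zeroˡ s)) ⟩
    a + 0#                 ≈⟨ +-identityʳ a ⟩
    a                      ∎)

  division-coeff : ∀ r a f i →
    coeff K (a ∷ f) i ≈ linearMulCoeff r (quotLinear r (a ∷ f)) i + coeff K (eval K (a ∷ f) r ∷ []) i
  division-coeff r a []      zero          = a≈-rs+[a+rs] a r 0#
  division-coeff r a []      (suc i)       = sym (trans (+-identityʳ _) (trans (+-identityʳ _) (zeroʳ _)))
  division-coeff r a (b ∷ f) zero          = a≈-rs+[a+rs] a r (eval K (b ∷ f) r)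
  division-coeff r a (b ∷ f) (suc zero)    = trans (division-coeff r b f zero) (sym (+-identityʳ _))
  division-coeff r a (b ∷ f) (suc (suc i)) = division-coeff r b f (suc i)

  division : ∀ r a f →
    (a ∷ f) ≈ₚ addP K (mulP K (linear K r) (quotLinear r (a ∷ f))) (eval K (a ∷ f) r ∷ [])
  division r a f i = trans (division-coeff r a f i)
    (sym (trans (coeff-addP (mulP K (linear K r) q) (s ∷ []) i) (+-congʳ (coeff-mulP-linear r q i))))
    where
    q : Poly K
    q = quotLinear r (a ∷ f)
    s : Carrier
    s = eval K (a ∷ f) r

  eval-division : ∀ r a f x →
    eval K (a ∷ f) x ≈ (x - r) * eval K (quotLinear r (a ∷ f)) x + eval K (a ∷ f) r
  eval-division r a f x = begin
    eval K (a ∷ f) x                   ≈⟨ eval-cong (a ∷ f) (addP K [X-r]q (s ∷ [])) (division r a f) x ⟩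
    eval K (addP K [X-r]q (s ∷ [])) x  ≈⟨ eval-addP [X-r]q (s ∷ []) x ⟩
    eval K [X-r]q x + eval K (s ∷ []) x ≈⟨ +-cong (eval-mulP-linear r q x) (eval-const s x) ⟩
    (x - r) * eval K q x + s           ∎
    where
    q [X-r]q : Poly K
    q = quotLinear r (a ∷ f)
    [X-r]q = mulP K (linear K r) q
    s : Carrier
    s = eval K (a ∷ f) r

  module _ (x*y≈0⇒y≈0 : ∀ {x y} → ¬ x ≈ 0# → x * y ≈ 0# → y ≈ 0#) where

    monic-roots⇒≈ₚprodP : ∀ rs f → IsMonic (length rs) f → AllPairs (λ r s → ¬ r ≈ s) rs →
                          All (IsRoot f) rs → f ≈ₚ prodP K (map (linear K) rs)
    monic-roots⇒≈ₚprodP []       f       f-monic _ _ = monic-degree0 f-monic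
    monic-roots⇒≈ₚprodP (r ∷ rs) (a ∷ f) f-monic (r∉rs ∷ rs-distinct) (r-root ∷ rs-roots) i = begin
      coeff K (a ∷ f) i                                   ≈⟨ division-coeff r a f i ⟩
      linearMulCoeff r q i + coeff K (eval K (a ∷ f) r ∷ []) i ≈⟨ +-congˡ (remainder≈0 i) ⟩
      linearMulCoeff r q i + 0#                           ≈⟨ +-identityʳ _ ⟩
      linearMulCoeff r q i                                ≈⟨ linearMulCoeff-cong r q≈∏ i ⟩
      linearMulCoeff r (prodP K (map (linear K) rs)) i    ≈⟨ coeff-mulP-linear r _ i ⟨
      coeff K (prodP K (map (linear K) (r ∷ rs))) i       ∎
      where
      q : Poly K
      q = quotLinear r (a ∷ f)
      remainder≈0 : ∀ i → coeff K (eval K (a ∷ f) r ∷ []) i ≈ 0#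
      remainder≈0 zero    = r-root
      remainder≈0 (suc i) = refl
      root-of-q : ∀ {r′} → ¬ r ≈ r′ → IsRoot (a ∷ f) r′ → IsRoot q r′
      root-of-q {r′} r≉r′ r′-root = x*y≈0⇒y≈0 (λ r′-r≈0 → r≉r′ (sym (x∙y⁻¹≈ε⇒x≈y r′ r r′-r≈0))) (begin
        (r′ - r) * eval K q r′                        ≈⟨ +-identityʳ _ ⟨
        (r′ - r) * eval K q r′ + 0#                   ≈⟨ +-congˡ r-root ⟨
        (r′ - r) * eval K q r′ + eval K (a ∷ f) r     ≈⟨ eval-division r a f r′ ⟨
        eval K (a ∷ f) r′                             ≈⟨ r′-root ⟩
        0#                                            ∎)
      q≈∏ : q ≈ₚ prodP K (map (linear K) rs)
      q≈∏ = monic-roots⇒≈ₚprodP rs q (quotLinear-monic r (a ∷ f) f-monic) rs-distinct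
              (All.zipWith (λ (r≉r′ , r′-root) → root-of-q r≉r′ r′-root) (r∉rs , rs-roots))

    binomial⇔equalPowers : ∀ τ rs → length rs ≡.≡ τ → 0 < τ → AllPairs (λ r s → ¬ r ≈ s) rs →
                           IsBinomial K (prodP K (map (linear K) rs)) τ ⇔ EqualPowers τ rs
    binomial⇔equalPowers .(length (r ∷ rs)) (r ∷ rs) ≡.refl _ distinct = mk⇔ to from
      where
      τ : ℕ
      τ = length (r ∷ rs)
      P : Poly K
      P = prodP K (map (linear K) (r ∷ rs))
      to : IsBinomial K P τ → EqualPowers τ (r ∷ rs)
      to (a , P≈B) = - a , All.tabulate (λ {s} s∈ → inverseʳ-unique a _ (begin
        a + pow K s τ                  ≈⟨ eval-binomialPoly τ a s ⟨
        eval K (binomialPoly K τ a) s  ≈⟨ eval-cong P (binomialPoly K τ a) P≈B s ⟨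
        eval K P s                     ≈⟨ IsRoot-prodP-linear s∈ ⟩
        0#                             ∎))
      from : EqualPowers τ (r ∷ rs) → IsBinomial K P τ
      from (b , powers≈b) = - b , λ i → sym (monic-roots⇒≈ₚprodP (r ∷ rs) (binomialPoly K τ (- b))
        (binomialPoly-monic (length rs) (- b)) distinct (All.map root-of-binomial powers≈b) i)
        where
        root-of-binomial : ∀ {s} → pow K s τ ≈ b → IsRoot (binomialPoly K τ (- b)) s
        root-of-binomial {s} sᵗ≈b =
          trans (eval-binomialPoly τ (- b) s) (trans (+-congˡ sᵗ≈b) (-‿inverseˡ b))

module Powers {c ℓ : Level} (K : CommutativeRing c ℓ) where

  open CommutativeRing K hiding (zero)
  open import Data.Nat.Base as ℕ using (ℕ; zero; suc; _%_; _/_)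
  open import Data.Nat.Properties using (≤-total; m≤n⇒∃[o]m+o≡n; suc-pred)
  open import Data.Nat.DivMod using (m≡m%n+[m/n]*n; m%n<n; %-remove-+ʳ)
  open import Data.Nat.Divisibility using (_∣_; m%n≡0⇒n∣m)
  open import Data.Product.Base using (_,_; proj₁; proj₂)
  open import Data.Sum.Base using (inj₁; inj₂)
  open import Function.Bundles using (_⇔_; mk⇔)
  open import Relation.Nullary using (¬_; contradiction)
  import Relation.Binary.PropositionalEquality as ≡
  open import Algebra.Properties.Semiring.Exp semiring as Exp using (^-homo-*; ^-assocʳ)
  open import Relation.Binary.Reasoning.Setoid setoid

  pow≡^ : ∀ x m → pow K x m ≡.≡ x Exp.^ m
  pow≡^ x zero    = ≡.refl
  pow≡^ x (suc m) = ≡.cong (x *_) (pow≡^ x m)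

  pow-homo-* : ∀ x m k → pow K x (m ℕ.+ k) ≈ pow K x m * pow K x k
  pow-homo-* x m k rewrite pow≡^ x (m ℕ.+ k) | pow≡^ x m | pow≡^ x k = ^-homo-* x m k

  pow-assocʳ : ∀ x m k → pow K (pow K x m) k ≈ pow K x (m ℕ.* k)
  pow-assocʳ x m k rewrite pow≡^ (pow K x m) k | pow≡^ x m | pow≡^ x (m ℕ.* k) = ^-assocʳ x m k

  unit-cancelˡ : ∀ {x w y y′} → w * x ≈ 1# → x * y ≈ x * y′ → y ≈ y′
  unit-cancelˡ {x} {w} {y} {y′} wx≈1 xy≈xy′ = begin
    y             ≈⟨ trans (*-congʳ wx≈1) (*-identityˡ y) ⟨
    (w * x) * y   ≈⟨ *-assoc w x y ⟩
    w * (x * y)   ≈⟨ *-congˡ xy≈xy′ ⟩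
    w * (x * y′)  ≈⟨ *-assoc w x y′ ⟨
    (w * x) * y′  ≈⟨ trans (*-congʳ wx≈1) (*-identityˡ y′) ⟩
    y′            ∎

  pow-unit-cancelˡ : ∀ {x w y y′} → w * x ≈ 1# → ∀ k → pow K x k * y ≈ pow K x k * y′ → y ≈ y′
  pow-unit-cancelˡ                  wx≈1 zero    eq = trans (sym (*-identityˡ _)) (trans eq (*-identityˡ _))
  pow-unit-cancelˡ {x} {y = y} {y′} wx≈1 (suc k) eq = pow-unit-cancelˡ wx≈1 k (unit-cancelˡ wx≈1 (begin
    x * (pow K x k * y)   ≈⟨ *-assoc x _ y ⟨
    pow K x (suc k) * y   ≈⟨ eq ⟩
    pow K x (suc k) * y′  ≈⟨ *-assoc x _ y′ ⟩
    x * (pow K x k * y′)  ∎))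

  x*y≈0⇒y≈0 : IsField K → ∀ {x y} → ¬ x ≈ 0# → x * y ≈ 0# → y ≈ 0#
  x*y≈0⇒y≈0 K-field {x} x≉0 xy≈0 with w , xw≈1 ← IsField.inverse K-field x x≉0 =
    unit-cancelˡ (trans (*-comm w x) xw≈1) (trans xy≈0 (sym (zeroʳ x)))

  module PrimitiveRoot (n : ℕ) .{{_ : NonZero n}} (z : Carrier) (z-primitive : IsPrimitiveRoot K n z) where

    private
      zⁿ≈1 : pow K z n ≈ 1#
      zⁿ≈1 = proj₁ z-primitive
      z-minimal : ∀ k → 0 ℕ.< k → k ℕ.< n → ¬ pow K z k ≈ 1#
      z-minimal = proj₂ z-primitive

    pow-multiple≈1 : ∀ k → pow K z (k ℕ.* n) ≈ 1#
    pow-multiple≈1 zero    = refl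
    pow-multiple≈1 (suc k) = begin
      pow K z (n ℕ.+ k ℕ.* n)          ≈⟨ pow-homo-* z n (k ℕ.* n) ⟩
      pow K z n * pow K z (k ℕ.* n)    ≈⟨ *-cong zⁿ≈1 (pow-multiple≈1 k) ⟩
      1# * 1#                          ≈⟨ *-identityˡ 1# ⟩
      1#                               ∎

    pow-mod : ∀ m → pow K z m ≈ pow K z (m % n)
    pow-mod m = begin
      pow K z m                                 ≡⟨ ≡.cong (pow K z) (m≡m%n+[m/n]*n m n) ⟩
      pow K z (m % n ℕ.+ m / n ℕ.* n)           ≈⟨ pow-homo-* z (m % n) _ ⟩
      pow K z (m % n) * pow K z (m / n ℕ.* n)   ≈⟨ *-congˡ (pow-multiple≈1 (m / n)) ⟩
      pow K z (m % n) * 1#                      ≈⟨ *-identityʳ _ ⟩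
      pow K z (m % n)                           ∎

    pow≈1⇒∣ : ∀ m → pow K z m ≈ 1# → n ∣ m
    pow≈1⇒∣ m zᵐ≈1 with m % n in m%n≡r
    ... | zero  = m%n≡0⇒n∣m m n m%n≡r
    ... | suc r = contradiction z^[1+r]≈1 (z-minimal (suc r) ℕ.z<s (≡.subst (ℕ._< n) m%n≡r (m%n<n m n)))
      where
      z^[1+r]≈1 : pow K z (suc r) ≈ 1#
      z^[1+r]≈1 = ≡.subst (λ e → pow K z e ≈ 1#) m%n≡r (trans (sym (pow-mod m)) zᵐ≈1)

    z-invertible : pow K z (ℕ.pred n) * z ≈ 1#
    z-invertible = begin
      pow K z (ℕ.pred n) * z  ≈⟨ *-comm _ z ⟩
      pow K z (suc (ℕ.pred n)) ≡⟨ ≡.cong (pow K z) (suc-pred n) ⟩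
      pow K z n               ≈⟨ zⁿ≈1 ⟩
      1#                      ∎

    pow≈pow⇔%≡% : ∀ a b → pow K z a ≈ pow K z b ⇔ a % n ≡.≡ b % n
    pow≈pow⇔%≡% a b = mk⇔ to from
      where
      from : a % n ≡.≡ b % n → pow K z a ≈ pow K z b
      from a%n≡b%n = begin
        pow K z a       ≈⟨ pow-mod a ⟩
        pow K z (a % n) ≡⟨ ≡.cong (pow K z) a%n≡b%n ⟩
        pow K z (b % n) ≈⟨ pow-mod b ⟨
        pow K z b       ∎
      ordered : ∀ {a b} → a ℕ.≤ b → pow K z a ≈ pow K z b → b % n ≡.≡ a % n
      ordered {a} {b} a≤b zᵃ≈zᵇ with d , ≡.refl ← m≤n⇒∃[o]m+o≡n a≤b =
        %-remove-+ʳ a (pow≈1⇒∣ d (pow-unit-cancelˡ z-invertible a (begin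
          pow K z a * pow K z d  ≈⟨ pow-homo-* z a d ⟨
          pow K z (a ℕ.+ d)      ≈⟨ zᵃ≈zᵇ ⟨
          pow K z a              ≈⟨ *-identityʳ _ ⟨
          pow K z a * 1#         ∎)))
      to : pow K z a ≈ pow K z b → a % n ≡.≡ b % n
      to zᵃ≈zᵇ with ≤-total a b
      ... | inj₁ a≤b = ≡.sym (ordered a≤b zᵃ≈zᵇ)
      ... | inj₂ b≤a = ordered b≤a (sym zᵃ≈zᵇ)

module CosetRoots {c ℓ : Level} (K : CommutativeRing c ℓ) (n q γ τ : ℕ) .{{_ : NonZero n}}
                  (z : CommutativeRing.Carrier K) (z-primitive : IsPrimitiveRoot K n z) where

  open CommutativeRing K hiding (zero)
  open import Data.Nat.Base as ℕ using (_%_)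
  import Data.Nat.Properties as ℕ
  open import Data.List.Base using (List; length; map; upTo)
  open import Data.List.Properties using (length-map; length-upTo)
  open import Data.List.Membership.Propositional.Properties using (∈-map⁺; ∈-upTo⁺)
  import Data.List.Relation.Unary.All as All
  import Data.List.Relation.Unary.All.Properties as All
  open import Data.List.Relation.Unary.AllPairs using (AllPairs)
  import Data.List.Relation.Unary.AllPairs.Properties as AllPairs
  open import Data.Product.Base using (_,_)
  open import Function.Base using (id)
  open import Function.Bundles using (_⇔_; mk⇔; Equivalence)
  open import Relation.Nullary using (¬_)
  open import Relation.Binary.Reasoning.Setoid setoid
  open ModularArithmetic.CyclotomicCoset n q γ τ
  open Polynomials K using (EqualPowers)
  open Powers K
  open PrimitiveRoot n z z-primitive

  root : ℕ → Carrier
  root j = pow K z (γ ℕ.* q ^ j)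

  roots : List Carrier
  roots = map root (upTo τ)

  length-roots : length roots ≡.≡ τ
  length-roots = ≡.trans (length-map root (upTo τ)) (length-upTo τ)

  roots-distinct : IsCosetSize n q γ τ → Coprime n q → AllPairs (λ r s → ¬ r ≈ s) roots
  roots-distinct size n⊥q = AllPairs.map⁺ (AllPairs.applyUpTo⁺₁ id τ λ i<j j<τ rootᵢ≈rootⱼ →
    cosetElem-distinct size n⊥q i<j j<τ (Equivalence.to (pow≈pow⇔%≡% _ _) rootᵢ≈rootⱼ))

  root^τ : ∀ j → pow K (root j) τ ≈ pow K z (γ ℕ.* q ^ j ℕ.* τ)
  root^τ j = pow-assocʳ z (γ ℕ.* q ^ j) τ

  equalPowers⇔timesτConstant : 0 < τ → EqualPowers τ roots ⇔ TimesτConstant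
  equalPowers⇔timesτConstant 0<τ = mk⇔ to from
    where
    to : EqualPowers τ roots → TimesτConstant
    to (b , powers≈b) j j<τ = ≡.subst (λ e → (γ ℕ.* q ^ j ℕ.* τ) % n ≡.≡ (e ℕ.* τ) % n) (ℕ.*-identityʳ γ)
      (Equivalence.to (pow≈pow⇔%≡% _ _) (begin
        pow K z (γ ℕ.* q ^ j ℕ.* τ)  ≈⟨ root^τ j ⟨
        pow K (root j) τ             ≈⟨ All.lookup powers≈b (∈-map⁺ root (∈-upTo⁺ j<τ)) ⟩
        b                            ≈⟨ All.lookup powers≈b (∈-map⁺ root (∈-upTo⁺ 0<τ)) ⟨
        pow K (root 0) τ             ≈⟨ root^τ 0 ⟩
        pow K z (γ ℕ.* 1 ℕ.* τ)      ∎))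
    from : TimesτConstant → EqualPowers τ roots
    from constant = pow K z (γ ℕ.* τ) , All.map⁺ (All.applyUpTo⁺₁ id τ λ {j} j<τ →
      trans (root^τ j) (Equivalence.from (pow≈pow⇔%≡% _ _) (constant j j<τ)))

theorem5p1 : ∀ {c ℓ : Level} (p k : ℕ) → Prime p → 0 < k →
    (K : CommutativeRing c ℓ) → IsAlgClosureOfFp K p →
    (ζ : ℕ → CommutativeRing.Carrier K) → CompatibleRoots K (p ^ k) ζ →
    (n : ℕ) .{{_ : NonZero n}} → Coprime n (p ^ k) →
    (γ : Fin n) (τ : ℕ) → IsCosetSize n (p ^ k) (toℕ γ) τ →
    IsBinomial K (minPolyCoset K ζ n (p ^ k) (toℕ γ) τ) τ
      ⇔ EqualDifference n (p ^ k) (toℕ γ) τ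
theorem5p1 p k _ _ K K-closure ζ ζ-compatible n n⊥q γ τ size@(0<τ , _) =
  ≡.subst (λ P → IsBinomial K P τ ⇔ EqualDifference n q g τ) (≡.sym minPolyCoset≡)
    (⇔-trans (binomial⇔equalPowers (x*y≈0⇒y≈0 (IsAlgClosureOfFp.isField K-closure))
                                   τ roots length-roots 0<τ (roots-distinct size n⊥q))
    (⇔-trans (equalPowers⇔timesτConstant 0<τ)
             (timesτConstant⇔equalDifference size n⊥q)))
  where
  q g : ℕ
  q = p ^ k
  g = toℕ γ
  open Polynomials K using (binomial⇔equalPowers)
  open Powers K using (x*y≈0⇒y≈0)
  open CosetRoots K n q g τ (ζ n) (CompatibleRoots.isPrimitive ζ-compatible n (>-nonZero⁻¹ n) n⊥q)
  open ModularArithmetic.CyclotomicCoset n q g τ using (timesτConstant⇔equalDifference)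
  minPolyCoset≡ : minPolyCoset K ζ n q g τ ≡.≡ prodP K (map (linear K) roots)
  minPolyCoset≡ = ≡.cong (prodP K) (map-∘ (upTo τ))
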